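{- Let $k\ge2$ and $u_0=[1,-1]$. Then (1) $OR_k\le^{acyc}_{con}\{Implies,u_0\}$, and (2) $NAND_k\le^{acyc}_{con}\{Implies,u_0\}$.
   Context: Constraint functions are $f:\{0,1\}^k\to\mathbb{C}$; symmetric functions are written $[a_0,\dots,a_k]$ ($a_i$ = value on inputs with exactly $i$ ones), binary ones as $(f(00),f(01),f(10),f(11))$. $u_0(0)=1$, $u_0(1)=-1$; $OR_k=[0,1,\dots,1]$ (value $1$ unless all inputs are $0$); $NAND_k=[1,\dots,1,0]$ (value $0$ iff all inputs are $1$); $Implies=(1,1,0,1)$. A hypergraph is acyclic if repeatedly deleting vertices lying in at most one hyperedge and deleting hyperedges empty or contained in another yields the empty hypergraph. $f\le^{acyc}_{con}\mathcal{G}$ ($f$ of arity $k$ on $x_1,\dots,x_k$) means: there exist $\lambda\ne0$, auxiliary variables $y_1,\dots,y_m$ and finitely many constraints $(g_j,(z^j_1,\dots,z^j_{d_j}))$, $g_j\in\mathcal{G}$, $z^j_\ell\in\{x_1,\dots,x_k,y_1,\dots,y_m\}$, whose hypergraph (vertices $x$'s and $y$'s, hyperedges $\{z^j_1,\dots,z^j_{d_j}\}$) is acyclic, with $f(x)=\lambda\sum_{y\in\{0,1\}^m}\prod_j g_j(z^j_1,\dots,z^j_{d_j})$ for all $x$. -}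

module Defs where

import Agda.Primitive

open import Data.Bool using (Bool; true; false; _∧_; not; if_then_else_)
open import Data.Nat using (ℕ; zero; suc; _≤_)
open import Data.Fin using (Fin; zero; suc)
open import Data.Fin.Properties using () renaming (_≟_ to _≟F_)
open import Data.List using (List; []; _∷_; _++_; map; filter; length; foldr; allFin)
open import Data.List.Membership.Propositional using (_∈_)
open import Data.List.Relation.Binary.Subset.Propositional using (_⊆_)
open import Data.Sum using (_⊎_; inj₁; inj₂)
open import Data.Sum.Properties using (≡-dec)
open import Data.Product using (Σ; _×_; _,_)
open import Data.Rational using (ℚ; 0ℚ; 1ℚ; -_; _*_; _+_)
open import Relation.Binary.Core using (Rel)
open import Relation.Binary.Definitions using (DecidableEquality)
open import Relation.Binary.Construct.Closure.ReflexiveTransitive using (Star)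
open import Relation.Binary.PropositionalEquality using (_≡_)
open import Relation.Nullary using (¬_)
open import Relation.Nullary.Decidable using (¬?)
import Data.List.Membership.DecPropositional as DecMem

-- Boolean inputs: false = 0, true = 1.  A constraint function of arity k
-- is a map (Fin k → Bool) → ℚ.

allTrue : (n : ℕ) → (Fin n → Bool) → Bool
allTrue zero    x = true
allTrue (suc n) x = x zero ∧ allTrue n (λ i → x (suc i))

OR : (k : ℕ) → (Fin k → Bool) → ℚ
OR k x = if allTrue k (λ i → not (x i)) then 0ℚ else 1ℚ

NAND : (k : ℕ) → (Fin k → Bool) → ℚ
NAND k x = if allTrue k x then 0ℚ else 1ℚ

Implies : (Fin 2 → Bool) → ℚ
Implies x = if x zero ∧ not (x (suc zero)) then 0ℚ else 1ℚ

u₀ : (Fin 1 → Bool) → ℚ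
u₀ x = if x zero then - 1ℚ else 1ℚ

module Hypergraph {V : Set} (_≟_ : DecidableEquality V) where
  open DecMem _≟_ using (_∈?_)

  -- a hypergraph state: list of vertices, list (multiset) of hyperedges,
  -- each hyperedge a list of vertices read as a set
  State : Set
  State = List V × List (List V)

  edgesContaining : V → List (List V) → ℕ
  edgesContaining v es = length (filter (λ e → v ∈? e) es)

  data Step : Rel State Agda.Primitive.lzero where
    del-vertex : ∀ vs₁ v vs₂ es → edgesContaining v es ≤ 1 →
      Step (vs₁ ++ v ∷ vs₂ , es)
           (vs₁ ++ vs₂ , map (filter (λ w → ¬? (w ≟ v))) es)
    del-empty : ∀ vs es₁ es₂ →
      Step (vs , es₁ ++ [] ∷ es₂) (vs , es₁ ++ es₂)
    del-contained : ∀ vs es₁ e es₂ e' → e' ∈ (es₁ ++ es₂) → e ⊆ e' →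
      Step (vs , es₁ ++ e ∷ es₂) (vs , es₁ ++ es₂)

  Acyclic : List V → List (List V) → Set
  Acyclic vs es = Star Step (vs , es) ([] , [])

record FunctionSet : Set₁ where
  field
    Label : Set
    arity : Label → ℕ
    fun   : (ℓ : Label) → (Fin (arity ℓ) → Bool) → ℚ

-- variables: x₁..x_k are inj₁, auxiliary y₁..y_m are inj₂
Var : ℕ → ℕ → Set
Var k m = Fin k ⊎ Fin m

record Constraint (𝒢 : FunctionSet) (k m : ℕ) : Set where
  open FunctionSet 𝒢
  field
    label : Label
    scope : Fin (arity label) → Var k m

module _ {𝒢 : FunctionSet} {k m : ℕ} where
  open FunctionSet 𝒢
  open Constraint

  hyperedge : Constraint 𝒢 k m → List (Var k m)
  hyperedge c = map (scope c) (allFin (arity (label c)))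

  evalC : (Fin k → Bool) → (Fin m → Bool) → Constraint 𝒢 k m → ℚ
  evalC x y c = fun (label c) (λ j → assign (scope c j))
    where
      assign : Var k m → Bool
      assign (inj₁ i) = x i
      assign (inj₂ i) = y i

allVars : (k m : ℕ) → List (Var k m)
allVars k m = map inj₁ (allFin k) ++ map inj₂ (allFin m)

sumAll : (m : ℕ) → ((Fin m → Bool) → ℚ) → ℚ
sumAll zero    g = g (λ ())
sumAll (suc m) g = sumAll m (λ y → g (cons false y)) + sumAll m (λ y → g (cons true y))
  where
    cons : Bool → (Fin m → Bool) → Fin (suc m) → Bool
    cons b y zero    = b
    cons b y (suc i) = y i

prodList : List ℚ → ℚ
prodList = foldr _*_ 1ℚ

_≤acyc-con_ : {k : ℕ} → ((Fin k → Bool) → ℚ) → FunctionSet → Set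
_≤acyc-con_ {k} f 𝒢 =
  Σ ℚ λ λ' → ¬ (λ' ≡ 0ℚ) ×
  Σ ℕ λ m → Σ (List (Constraint 𝒢 k m)) λ cs →
    Hypergraph.Acyclic (≡-dec _≟F_ _≟F_) (allVars k m) (map hyperedge cs) ×
    (∀ (x : Fin k → Bool) →
       f x ≡ λ' * sumAll m (λ y → prodList (map (evalC x y) cs)))

data ImpU : Set where
  implies u0 : ImpU

ImpliesU₀ : FunctionSet
ImpliesU₀ = record
  { Label = ImpU
  ; arity = λ { implies → 2 ; u0 → 1 }
  ; fun   = λ { implies → Implies ; u0 → u₀ }
  }

-- Take one auxiliary variable y, weighted by u₀, and join it to every xᵢ by an
-- Implies constraint: the constraint hypergraph is a star, hence acyclic.  With
-- the constraints xᵢ → y, the term y = 0 contributes [x = 0] and the term y = 1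
-- contributes −1, so the sum is [x = 0] − 1 = −OR_k(x).  With the constraints
-- y → xᵢ, the term y = 0 contributes 1 and the term y = 1 contributes −[x = 1],
-- so the sum is NAND_k(x).
module Submission where

open import Defs
open import Data.Bool using (Bool; true; false; not; _∧_; if_then_else_)
open import Data.Empty using (⊥-elim)
open import Data.Fin using (Fin; zero; suc)
open import Data.Fin.Properties using () renaming (_≟_ to _≟F_)
open import Data.List using (List; []; _∷_; _++_; map; filter; length; tabulate; allFin)
open import Data.List.Membership.Propositional using (_∉_)
open import Data.List.Membership.Propositional.Properties using (∈-filter⁻)
open import Data.List.Properties using (map-tabulate; tabulate-cong; filter-all; filter-none)
open import Data.List.Relation.Binary.Subset.Propositional using (_⊆_)
open import Data.List.Relation.Unary.All as All using (All; []; _∷_)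
open import Data.List.Relation.Unary.All.Properties using (map⁺)
open import Data.List.Relation.Unary.Any using (here)
open import Data.List.Relation.Unary.AllPairs using (_∷_)
open import Data.List.Relation.Unary.Unique.Propositional using (Unique)
open import Data.List.Relation.Unary.Unique.Propositional.Properties using (allFin⁺)
open import Data.Nat using (ℕ; _≤_; z≤n; s≤s)
open import Data.Nat.Properties using (≤-reflexive; m≤n⇒m≤1+n)
open import Data.Product using (_×_; _,_)
open import Data.Rational using (ℚ; 0ℚ; 1ℚ; -_; _*_; _+_; _-_)
open import Data.Rational.Properties using (*-identityˡ; *-zeroˡ; neg-distribˡ-*)
open import Data.Sum using (_⊎_; inj₁; inj₂)
open import Data.Sum.Properties using (≡-dec)
open import Function using (_∘_)
open import Relation.Binary.Construct.Closure.ReflexiveTransitive using (Star; ε; _◅_)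
open import Relation.Binary.PropositionalEquality
open import Relation.Nullary using (yes; no)
open import Relation.Nullary.Decidable using (¬?)
open import Relation.Binary.Definitions using (DecidableEquality)
import Data.List.Membership.DecPropositional as DecMem

𝟙 : Bool → ℚ
𝟙 b = if b then 1ℚ else 0ℚ

𝟙-∧ : ∀ a b → 𝟙 (a ∧ b) ≡ 𝟙 a * 𝟙 b
𝟙-∧ true  b = sym (*-identityˡ (𝟙 b))
𝟙-∧ false b = sym (*-zeroˡ (𝟙 b))

allTrue-const : ∀ n → allTrue n (λ _ → true) ≡ true
allTrue-const ℕ.zero    = refl
allTrue-const (ℕ.suc n) = allTrue-const n

prodList-tabulate-𝟙 : ∀ n {f : Fin n → ℚ} (p : Fin n → Bool) →
  (∀ i → f i ≡ 𝟙 (p i)) → prodList (tabulate f) ≡ 𝟙 (allTrue n p)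
prodList-tabulate-𝟙 ℕ.zero    p f≡𝟙p = refl
prodList-tabulate-𝟙 (ℕ.suc n) p f≡𝟙p =
  trans (cong₂ _*_ (f≡𝟙p zero) (prodList-tabulate-𝟙 n (p ∘ suc) (f≡𝟙p ∘ suc)))
        (sym (𝟙-∧ (p zero) (allTrue n (p ∘ suc))))

sumAll-one : (g : (Fin 1 → Bool) → ℚ) (h : Bool → ℚ) →
  (∀ y → g y ≡ h (y zero)) → sumAll 1 g ≡ h false + h true
sumAll-one g h g≡h = cong₂ _+_ (g≡h _) (g≡h _)

module StarGadget (k : ℕ) where

  _≟_ : DecidableEquality (Var k 1)
  _≟_ = ≡-dec _≟F_ _≟F_

  open Hypergraph _≟_
  open DecMem _≟_ using (_∈?_)

  centre : Var k 1
  centre = inj₂ zero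

  Spoke : Fin k → Var k 1 → Set
  Spoke j v = v ≡ inj₁ j ⊎ v ≡ centre

  Spoke-≢ : ∀ {i j w} → i ≢ j → Spoke j w → w ≢ inj₁ i
  Spoke-≢ i≢j (inj₁ refl) refl = i≢j refl
  Spoke-≢ i≢j (inj₂ refl) ()

  Spoke-∉ : ∀ {i j e} → i ≢ j → All (Spoke j) e → inj₁ i ∉ e
  Spoke-∉ i≢j spokes i∈e = Spoke-≢ i≢j (All.lookup spokes i∈e) refl

  remove : Var k 1 → List (Var k 1) → List (Var k 1)
  remove v = filter (λ w → ¬? (w ≟ v))

  remove-vertex-of-spoke : ∀ {i e} → All (Spoke i) e → remove (inj₁ i) e ⊆ centre ∷ []
  remove-vertex-of-spoke spokes w∈ with ∈-filter⁻ (λ w → ¬? (w ≟ _)) w∈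
  ... | w∈e , w≢i with All.lookup spokes w∈e
  ...   | inj₁ w≡i = ⊥-elim (w≢i w≡i)
  ...   | inj₂ refl = here refl

  edgesContaining-none : ∀ v es → All (v ∉_) es → edgesContaining v es ≡ 0
  edgesContaining-none v es v∉es = cong length (filter-none (v ∈?_) v∉es)

  edgesContaining-≤1 : ∀ v e es → All (v ∉_) es → edgesContaining v (e ∷ es) ≤ 1
  edgesContaining-≤1 v e es v∉es with v ∈? e
  ... | yes _ = s≤s (≤-reflexive (edgesContaining-none v es v∉es))
  ... | no  _ = m≤n⇒m≤1+n (≤-reflexive (edgesContaining-none v es v∉es))

  -- Delete x_i for each i in turn: it lies only in its own spoke, whose remainder
  -- is then a subset of the edge {y}; finally delete y and the empty edge.
  star-reduces : (E : Fin k → List (Var k 1)) → (∀ j → All (Spoke j) (E j)) →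
    ∀ ls → Unique ls →
    Star Step (map inj₁ ls ++ centre ∷ [] , (centre ∷ []) ∷ map E ls) ([] , [])
  star-reduces E spokes [] _ =
    del-vertex [] centre [] ((centre ∷ []) ∷ []) (s≤s z≤n) ◅ del-empty [] [] [] ◅ ε
  star-reduces E spokes (i ∷ ls) (i∉ls ∷ unique) =
    del-vertex [] (inj₁ i) (map inj₁ ls ++ centre ∷ []) edges
      (edgesContaining-≤1 (inj₁ i) (E i) (map E ls) (map⁺ (All.map others-∌i i∉ls)))
    ◅ subst (λ es → Star Step (map inj₁ ls ++ centre ∷ [] , es) ([] , [])) (sym removed)
        (del-contained _ ((centre ∷ []) ∷ []) (remove (inj₁ i) (E i)) (map E ls)
           (centre ∷ []) (here refl) (remove-vertex-of-spoke (spokes i))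
         ◅ star-reduces E spokes ls unique)
    where
      edges : List (List (Var k 1))
      edges = (centre ∷ []) ∷ E i ∷ map E ls

      others-∌i : ∀ {j} → i ≢ j → inj₁ i ∉ E j
      others-∌i i≢j = Spoke-∉ i≢j (spokes _)

      others-unchanged : ∀ ls → All (i ≢_) ls → map (remove (inj₁ i)) (map E ls) ≡ map E ls
      others-unchanged []       []            = refl
      others-unchanged (j ∷ ls) (i≢j ∷ i∉ls) =
        cong₂ _∷_ (filter-all (λ w → ¬? (w ≟ inj₁ i)) (All.map (Spoke-≢ i≢j) (spokes j)))
                  (others-unchanged ls i∉ls)

      removed : map (remove (inj₁ i)) edges
              ≡ (centre ∷ []) ∷ remove (inj₁ i) (E i) ∷ map E ls
      removed = cong ((centre ∷ []) ∷_) (cong (remove (inj₁ i) (E i) ∷_) (others-unchanged ls i∉ls))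

  Gadget : Set
  Gadget = List (Constraint ImpliesU₀ k 1)

  star : (Fin k → Constraint ImpliesU₀ k 1) → Gadget
  star c = record { label = u0 ; scope = λ _ → centre } ∷ tabulate c

  star-acyclic : (c : Fin k → Constraint ImpliesU₀ k 1) →
    (∀ j → All (Spoke j) (hyperedge (c j))) →
    Acyclic (allVars k 1) (map hyperedge (star c))
  star-acyclic c spokes =
    subst (Acyclic (allVars k 1)) (cong ((centre ∷ []) ∷_) star-edges)
      (star-reduces (hyperedge ∘ c) spokes (allFin k) (allFin⁺ k))
    where
      star-edges : map (hyperedge ∘ c) (allFin k) ≡ map hyperedge (tabulate c)
      star-edges = trans (map-tabulate (λ i → i) (hyperedge ∘ c)) (sym (map-tabulate c hyperedge))

  gadgetValue : Gadget → (Fin k → Bool) → ℚ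
  gadgetValue cs x = sumAll 1 (λ y → prodList (map (evalC x y) cs))

  star-value : (c : Fin k → Constraint ImpliesU₀ k 1) (x : Fin k → Bool)
    (φ : Bool → Fin k → ℚ) → (∀ y i → evalC x y (c i) ≡ φ (y zero) i) →
    gadgetValue (star c) x ≡ prodList (tabulate (φ false)) - prodList (tabulate (φ true))
  star-value c x φ c≡φ =
    trans (sumAll-one _ (λ v → u₀ (λ _ → v) * prodList (tabulate (φ v))) at-y)
          (cong₂ _+_ (*-identityˡ (prodList (tabulate (φ false)))) (-1*p≡-p (prodList (tabulate (φ true)))))
    where
      at-y : ∀ y → prodList (map (evalC x y) (star c))
                 ≡ u₀ (λ _ → y zero) * prodList (tabulate (φ (y zero)))
      at-y y = cong (u₀ (λ _ → y zero) *_)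
        (cong prodList (trans (map-tabulate c (evalC x y)) (tabulate-cong (c≡φ y))))

      -1*p≡-p : ∀ p → - 1ℚ * p ≡ - p
      -1*p≡-p p = trans (sym (neg-distribˡ-* 1ℚ p)) (cong -_ (*-identityˡ p))

  implication : Var k 1 → Var k 1 → Constraint ImpliesU₀ k 1
  implication a b = record { label = implies ; scope = λ { zero → a ; (suc _) → b } }

  orGadget : Gadget
  orGadget = star (λ i → implication (inj₁ i) centre)

  nandGadget : Gadget
  nandGadget = star (λ i → implication centre (inj₁ i))

  orGadget-acyclic : Acyclic (allVars k 1) (map hyperedge orGadget)
  orGadget-acyclic = star-acyclic _ (λ _ → inj₁ refl ∷ inj₂ refl ∷ [])

  nandGadget-acyclic : Acyclic (allVars k 1) (map hyperedge nandGadget)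
  nandGadget-acyclic = star-acyclic _ (λ _ → inj₂ refl ∷ inj₁ refl ∷ [])

  orGadget-value : ∀ x → gadgetValue orGadget x ≡ 𝟙 (allTrue k (not ∘ x)) - 1ℚ
  orGadget-value x = begin
    gadgetValue orGadget x
      ≡⟨ star-value _ x (λ v i → if x i ∧ not v then 0ℚ else 1ℚ) (λ _ _ → refl) ⟩
    prodList (tabulate (λ i → if x i ∧ true then 0ℚ else 1ℚ))
      - prodList (tabulate (λ i → if x i ∧ false then 0ℚ else 1ℚ))
      ≡⟨ cong₂ _-_ (prodList-tabulate-𝟙 k (not ∘ x) at-y≡0)
                   (trans (prodList-tabulate-𝟙 k (λ _ → true) at-y≡1) (cong 𝟙 (allTrue-const k))) ⟩
    𝟙 (allTrue k (not ∘ x)) - 1ℚ ∎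
    where
      open ≡-Reasoning

      at-y≡0 : ∀ i → (if x i ∧ true then 0ℚ else 1ℚ) ≡ 𝟙 (not (x i))
      at-y≡0 i with x i
      ... | true  = refl
      ... | false = refl

      at-y≡1 : ∀ i → (if x i ∧ false then 0ℚ else 1ℚ) ≡ 𝟙 true
      at-y≡1 i with x i
      ... | true  = refl
      ... | false = refl

  nandGadget-value : ∀ x → gadgetValue nandGadget x ≡ 1ℚ - 𝟙 (allTrue k x)
  nandGadget-value x = begin
    gadgetValue nandGadget x
      ≡⟨ star-value _ x (λ v i → if v ∧ not (x i) then 0ℚ else 1ℚ) (λ _ _ → refl) ⟩
    prodList (tabulate (λ (_ : Fin k) → 1ℚ)) - prodList (tabulate (λ i → if not (x i) then 0ℚ else 1ℚ))
      ≡⟨ cong₂ _-_ (trans (prodList-tabulate-𝟙 k (λ _ → true) (λ _ → refl)) (cong 𝟙 (allTrue-const k)))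
                   (prodList-tabulate-𝟙 k x at-y≡1) ⟩
    1ℚ - 𝟙 (allTrue k x) ∎
    where
      open ≡-Reasoning

      at-y≡1 : ∀ i → (if not (x i) then 0ℚ else 1ℚ) ≡ 𝟙 (x i)
      at-y≡1 i with x i
      ... | true  = refl
      ... | false = refl

  OR-realised : ∀ x → OR k x ≡ - 1ℚ * gadgetValue orGadget x
  OR-realised x = trans (OR-by-𝟙 (allTrue k (not ∘ x))) (sym (cong (- 1ℚ *_) (orGadget-value x)))
    where
      OR-by-𝟙 : ∀ b → (if b then 0ℚ else 1ℚ) ≡ - 1ℚ * (𝟙 b - 1ℚ)
      OR-by-𝟙 true  = refl
      OR-by-𝟙 false = refl

  NAND-realised : ∀ x → NAND k x ≡ 1ℚ * gadgetValue nandGadget x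
  NAND-realised x = trans (NAND-by-𝟙 (allTrue k x)) (sym (cong (1ℚ *_) (nandGadget-value x)))
    where
      NAND-by-𝟙 : ∀ b → (if b then 0ℚ else 1ℚ) ≡ 1ℚ * (1ℚ - 𝟙 b)
      NAND-by-𝟙 true  = refl
      NAND-by-𝟙 false = refl

lemma3p5 : (k : ℕ) → 2 ≤ k →
    (OR k ≤acyc-con ImpliesU₀) × (NAND k ≤acyc-con ImpliesU₀)
lemma3p5 k _ =
  (- 1ℚ , (λ ()) , 1 , orGadget , orGadget-acyclic , OR-realised) ,
  (1ℚ , (λ ()) , 1 , nandGadget , nandGadget-acyclic , NAND-realised)
  where open StarGadget k
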